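{- The rule $\mathsf{cut}$: from $\Gamma\Rightarrow A$ and $\Sigma,A\Rightarrow C$ infer $\Gamma,\Sigma\Rightarrow C$, is admissible in the sequent calculus $\mathsf{G1MK}$; that is, whenever both premisses are derivable in $\mathsf{G1MK}$, so is the conclusion.
   Context: Formulas are from the language $A ::= p \mid \bot \mid A\wedge A \mid A\vee A \mid A\to A \mid \Box A \mid \Diamond A$. A sequent is $\Gamma\Rightarrow\Delta$ with $\Gamma,\Delta$ finite multisets of formulas; for a multiset $\Sigma=A_1,\dots,A_n$, $\Box\Sigma=\Box A_1,\dots,\Box A_n$. A derivation is a finite tree of sequents whose leaves are initial sequents and each inner node follows from its children by a rule. $\mathsf{G1MK}$ has single-succedent sequents ($\Gamma$ a multiset, $C$ a single formula) with: initial sequents $A\Rightarrow A$; (L$\wedge$) $\Gamma,A_i\Rightarrow C$ / $\Gamma,A_1\wedge A_2\Rightarrow C$ ($i=1,2$); (R$\wedge$) $\Gamma\Rightarrow A$ and $\Gamma\Rightarrow B$ / $\Gamma\Rightarrow A\wedge B$; (L$\vee$) $\Gamma,A\Rightarrow C$ and $\Gamma,B\Rightarrow C$ / $\Gamma,A\vee B\Rightarrow C$; (R$\vee$) $\Gamma\Rightarrow A_i$ / $\Gamma\Rightarrow A_1\vee A_2$; (R$\to$) $\Gamma,A\Rightarrow B$ / $\Gamma\Rightarrow A\to B$; (L$\to$) $\Gamma\Rightarrow A$ and $\Gamma,B\Rightarrow C$ / $\Gamma,A\to B\Rightarrow C$; (LW) $\Gamma\Rightarrow C$ / $\Gamma,A\Rightarrow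 C$; (LC) $\Gamma,A,A\Rightarrow C$ / $\Gamma,A\Rightarrow C$; (K$\Box$) $\Sigma\Rightarrow A$ / $\Box\Sigma\Rightarrow\Box A$; (K$\Diamond$) $\Sigma,A\Rightarrow B$ / $\Box\Sigma,\Diamond A\Rightarrow\Diamond B$. -}

module Defs where

open import Data.Nat using (ℕ)
open import Data.List using (List; []; _∷_; _++_; map)
open import Data.List.Relation.Binary.Permutation.Propositional using (_↭_)

data Fm : Set where
  var  : ℕ → Fm
  bot  : Fm
  _∧′_ : Fm → Fm → Fm
  _∨′_ : Fm → Fm → Fm
  _⇒′_ : Fm → Fm → Fm
  □_   : Fm → Fm
  ◇_   : Fm → Fm

□* : List Fm → List Fm
□* = map □_

-- Antecedents are finite multisets, represented as lists identified up to
-- permutation (rule 'perm' below, which just makes derivability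
-- invariant under the multiset identity of the antecedent).
infix 3 _⊢_
data _⊢_ : List Fm → Fm → Set where
  perm : ∀ {Γ Γ′ C} → Γ ↭ Γ′ → Γ ⊢ C → Γ′ ⊢ C
  ax   : ∀ {A} → A ∷ [] ⊢ A
  L∧₁  : ∀ {Γ A B C} → A ∷ Γ ⊢ C → (A ∧′ B) ∷ Γ ⊢ C
  L∧₂  : ∀ {Γ A B C} → B ∷ Γ ⊢ C → (A ∧′ B) ∷ Γ ⊢ C
  R∧   : ∀ {Γ A B} → Γ ⊢ A → Γ ⊢ B → Γ ⊢ A ∧′ B
  L∨   : ∀ {Γ A B C} → A ∷ Γ ⊢ C → B ∷ Γ ⊢ C → (A ∨′ B) ∷ Γ ⊢ C
  R∨₁  : ∀ {Γ A B} → Γ ⊢ A → Γ ⊢ A ∨′ B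
  R∨₂  : ∀ {Γ A B} → Γ ⊢ B → Γ ⊢ A ∨′ B
  R⇒   : ∀ {Γ A B} → A ∷ Γ ⊢ B → Γ ⊢ A ⇒′ B
  L⇒   : ∀ {Γ A B C} → Γ ⊢ A → B ∷ Γ ⊢ C → (A ⇒′ B) ∷ Γ ⊢ C
  LW   : ∀ {Γ A C} → Γ ⊢ C → A ∷ Γ ⊢ C
  LC   : ∀ {Γ A C} → A ∷ A ∷ Γ ⊢ C → A ∷ Γ ⊢ C
  K□   : ∀ {Σ A} → Σ ⊢ A → □* Σ ⊢ □ A
  K◇   : ∀ {Σ A B} → A ∷ Σ ⊢ B → (◇ A) ∷ □* Σ ⊢ ◇ B

-- Since the antecedent admits exchange, weakening and contraction, derivability
-- depends only on the set of antecedent formulas.  So it suffices to cut into a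
-- context Θ containing both premises' antecedents, with every occurrence of the
-- cut formula A removed at once ("multicut").  The proof is by induction on A,
-- then on the left derivation, then on the right one: left rules on the left are
-- permuted upwards; when the left derivation ends in a right rule, the cut is
-- pushed into the right derivation, and a principal occurrence of A there is
-- replaced by cuts on immediate subformulas of A.  In the modal case a K□ on the
-- left meets every boxed copy of A in a K□ or K◇ on the right at once.
module Submission where

open import Defs
open import Data.List using (List; []; _∷_; _++_)
open import Data.List.Properties using (map-++)
open import Data.List.Membership.Propositional using (_∈_; _∉_)
open import Data.List.Membership.Propositional.Properties using (∈-∃++; ∈-map⁻; ∈-++⁻; ∈-++⁺ʳ)
open import Data.List.Relation.Unary.Any using (here; there)
open import Data.List.Relation.Binary.Subset.Propositional using (_⊆_)
open import Data.List.Relation.Binary.Subset.Propositional.Properties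
  using (⊆-refl; ⊆-trans; ∷⁺ʳ; ∈-∷⁺ʳ; ⊆∷∧∉⇒⊆; xs⊆xs++ys; xs⊆ys++xs)
open import Data.List.Relation.Binary.Permutation.Propositional using (↭-sym; prep)
open import Data.List.Relation.Binary.Permutation.Propositional.Properties
  using (∈-resp-↭; shift; ++-comm)
open import Data.Product using (∃; _×_; _,_)
open import Data.Sum using ([_,_]′)
open import Function using (_∘′_)
open import Relation.Binary.PropositionalEquality using (_≢_; refl; subst)

private
  variable
    Γ Δ Θ Σ Σ₁ Σ₂ : List Fm
    A B C D P X : Fm

weaken-++ : ∀ Ξ → Δ ⊢ C → Ξ ++ Δ ⊢ C
weaken-++ []      d = d
weaken-++ (_ ∷ Ξ) d = LW (weaken-++ Ξ d)

contract-∈ : A ∈ Δ → A ∷ Δ ⊢ C → Δ ⊢ C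
contract-∈ {A} A∈Δ d with Δ₁ , Δ₂ , refl ← ∈-∃++ A∈Δ =
  perm (↭-sym (shift A Δ₁ Δ₂)) (LC (perm (prep A (shift A Δ₁ Δ₂)) d))

absorb : ∀ Δ → Δ ⊆ Θ → Δ ++ Θ ⊢ C → Θ ⊢ C
absorb []      Δ⊆Θ d = d
absorb (A ∷ Δ) Δ⊆Θ d = absorb Δ (Δ⊆Θ ∘′ there) (contract-∈ (∈-++⁺ʳ Δ (Δ⊆Θ (here refl))) d)

⊢-resp-⊆ : Δ ⊆ Θ → Δ ⊢ C → Θ ⊢ C
⊢-resp-⊆ {Δ} {Θ} Δ⊆Θ d = absorb Δ Δ⊆Θ (perm (++-comm Θ Δ) (weaken-++ Θ d))

∷⁺-under : Δ ⊆ A ∷ Θ → X ∷ Δ ⊆ A ∷ X ∷ Θ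
∷⁺-under Δ⊆AΘ (here refl) = there (here refl)
∷⁺-under Δ⊆AΘ (there x∈Δ) with Δ⊆AΘ x∈Δ
... | here x≡A  = here x≡A
... | there x∈Θ = there (there x∈Θ)

□*-++-⊆ : □* Σ₁ ⊆ Θ → □* Σ₂ ⊆ Θ → □* (Σ₁ ++ Σ₂) ⊆ Θ
□*-++-⊆ {Σ₁ = Σ₁} {Σ₂ = Σ₂} u v = [ u , v ]′ ∘′ ∈-++⁻ (□* Σ₁) ∘′ subst (_ ∈_) (map-++ □_ Σ₁ Σ₂)

∉-□* : (∀ {B} → A ≢ □ B) → A ∉ □* Σ
∉-□* A≢□ A∈□Σ with _ , _ , A≡□B ← ∈-map⁻ □_ A∈□Σ = A≢□ A≡□B

∉-◇∷□* : (∀ {B} → A ≢ ◇ B) → (∀ {B} → A ≢ □ B) → A ∉ ◇ P ∷ □* Σ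
∉-◇∷□* A≢◇ _   (here A≡◇P)  = A≢◇ A≡◇P
∉-◇∷□* _   A≢□ (there A∈□Σ) = ∉-□* A≢□ A∈□Σ

-- Σ′ is read off the membership proofs, so no decidable equality on Fm is needed.
□*-⊆-□∷ : □* Σ ⊆ □ B ∷ Θ → ∃ λ Σ′ → □* Σ′ ⊆ Θ × Σ ⊆ B ∷ Σ′
□*-⊆-□∷ {Σ = []}    _ = [] , (λ ()) , (λ ())
□*-⊆-□∷ {Σ = A ∷ Σ} t with □*-⊆-□∷ (t ∘′ there) | t (here refl)
... | Σ′ , u , v | here refl   = Σ′ , u , ∈-∷⁺ʳ (here refl) v
... | Σ′ , u , v | there □A∈Θ = A ∷ Σ′ , ∈-∷⁺ʳ □A∈Θ u , ∷⁺-under v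

infix 3 _⊢ʳ_
data _⊢ʳ_ : List Fm → Fm → Set where
  R∧  : Γ ⊢ A → Γ ⊢ B → Γ ⊢ʳ A ∧′ B
  R∨₁ : Γ ⊢ A → Γ ⊢ʳ A ∨′ B
  R∨₂ : Γ ⊢ B → Γ ⊢ʳ A ∨′ B
  R⇒  : A ∷ Γ ⊢ B → Γ ⊢ʳ A ⇒′ B
  K□  : Σ ⊢ A → □* Σ ⊢ʳ □ A
  K◇  : A ∷ Σ ⊢ B → ◇ A ∷ □* Σ ⊢ʳ ◇ B

⌊_⌋ : Γ ⊢ʳ A → Γ ⊢ A
⌊ R∧ d₁ d₂ ⌋ = R∧ d₁ d₂
⌊ R∨₁ d ⌋    = R∨₁ d
⌊ R∨₂ d ⌋    = R∨₂ d
⌊ R⇒ d ⌋     = R⇒ d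
⌊ K□ d ⌋     = K□ d
⌊ K◇ d ⌋     = K◇ d

cut-⊆     : Γ ⊢ A → Δ ⊢ C → Γ ⊆ Θ → Δ ⊆ A ∷ Θ → Θ ⊢ C
cut-⊆-∷   : X ∷ Γ ⊢ A → Δ ⊢ C → Γ ⊆ Θ → Δ ⊆ A ∷ Θ → X ∷ Θ ⊢ C
cutʳ-⊆    : Γ ⊢ʳ A → Δ ⊢ C → Γ ⊆ Θ → Δ ⊆ A ∷ Θ → Θ ⊢ C
cutʳ-⊆-∷  : Γ ⊢ʳ A → X ∷ Δ ⊢ C → Γ ⊆ Θ → Δ ⊆ A ∷ Θ → X ∷ Θ ⊢ C
cut-R∨-L∨ : Γ ⊢ʳ A ∨′ B → A ∷ Θ ⊢ C → B ∷ Θ ⊢ C → Γ ⊆ Θ → Θ ⊢ C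
cut-K□    : Γ ⊢ʳ A → Σ ⊢ D → Γ ⊆ Θ → □* Σ ⊆ A ∷ Θ → Θ ⊢ □ D
cut-K◇    : Γ ⊢ʳ A → P ∷ Σ ⊢ D → Γ ⊆ Θ → ◇ P ∷ □* Σ ⊆ A ∷ Θ → Θ ⊢ ◇ D

cut-⊆ (perm π d) e s t = cut-⊆ d e (s ∘′ ∈-resp-↭ π) t
cut-⊆ ax         e s t = ⊢-resp-⊆ (⊆-trans t (∈-∷⁺ʳ (s (here refl)) ⊆-refl)) e
cut-⊆ (L∧₁ d)    e s t = contract-∈ (s (here refl)) (L∧₁ (cut-⊆-∷ d e (s ∘′ there) t))
cut-⊆ (L∧₂ d)    e s t = contract-∈ (s (here refl)) (L∧₂ (cut-⊆-∷ d e (s ∘′ there) t))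
cut-⊆ (L∨ d₁ d₂) e s t = contract-∈ (s (here refl))
  (L∨ (cut-⊆-∷ d₁ e (s ∘′ there) t) (cut-⊆-∷ d₂ e (s ∘′ there) t))
cut-⊆ (L⇒ d₁ d₂) e s t = contract-∈ (s (here refl))
  (L⇒ (⊢-resp-⊆ (s ∘′ there) d₁) (cut-⊆-∷ d₂ e (s ∘′ there) t))
cut-⊆ (LW d)     e s t = cut-⊆ d e (s ∘′ there) t
cut-⊆ (LC d)     e s t = cut-⊆ d e (∈-∷⁺ʳ (s (here refl)) s) t
cut-⊆ (R∧ d₁ d₂) e s t = cutʳ-⊆ (R∧ d₁ d₂) e s t
cut-⊆ (R∨₁ d)    e s t = cutʳ-⊆ (R∨₁ d) e s t
cut-⊆ (R∨₂ d)    e s t = cutʳ-⊆ (R∨₂ d) e s t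
cut-⊆ (R⇒ d)     e s t = cutʳ-⊆ (R⇒ d) e s t
cut-⊆ (K□ d)     e s t = cutʳ-⊆ (K□ d) e s t
cut-⊆ (K◇ d)     e s t = cutʳ-⊆ (K◇ d) e s t

cut-⊆-∷ d e s t = cut-⊆ d e (∷⁺ʳ _ s) (∷⁺-under t ∘′ there)

cutʳ-⊆ d (perm π e) s t = cutʳ-⊆ d e s (t ∘′ ∈-resp-↭ π)
cutʳ-⊆ d ax s t with t (here refl)
... | here refl = ⊢-resp-⊆ s ⌊ d ⌋
... | there C∈Θ = ⊢-resp-⊆ (∈-∷⁺ʳ C∈Θ (λ ())) ax
cutʳ-⊆ d (L∧₁ e) s t with t (here refl) | cutʳ-⊆-∷ d e s (t ∘′ there)
... | here refl | e′ with R∧ d₁ _ ← d = cut-⊆ d₁ e′ s ⊆-refl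
... | there m   | e′ = contract-∈ m (L∧₁ e′)
cutʳ-⊆ d (L∧₂ e) s t with t (here refl) | cutʳ-⊆-∷ d e s (t ∘′ there)
... | here refl | e′ with R∧ _ d₂ ← d = cut-⊆ d₂ e′ s ⊆-refl
... | there m   | e′ = contract-∈ m (L∧₂ e′)
cutʳ-⊆ d (L∨ e₁ e₂) s t
  with t (here refl) | cutʳ-⊆-∷ d e₁ s (t ∘′ there) | cutʳ-⊆-∷ d e₂ s (t ∘′ there)
... | here refl | e₁′ | e₂′ = cut-R∨-L∨ d e₁′ e₂′ s
... | there m   | e₁′ | e₂′ = contract-∈ m (L∨ e₁′ e₂′)
cutʳ-⊆ d (L⇒ e₁ e₂) s t
  with t (here refl) | cutʳ-⊆ d e₁ s (t ∘′ there) | cutʳ-⊆-∷ d e₂ s (t ∘′ there)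
... | here refl | e₁′ | e₂′ with R⇒ d′ ← d =
  cut-⊆ e₁′ (cut-⊆ d′ e₂′ (∷⁺ʳ _ s) (∷⁺ʳ _ there)) ⊆-refl ⊆-refl
... | there m   | e₁′ | e₂′ = contract-∈ m (L⇒ e₁′ e₂′)
cutʳ-⊆ d (R∧ e₁ e₂) s t = R∧ (cutʳ-⊆ d e₁ s t) (cutʳ-⊆ d e₂ s t)
cutʳ-⊆ d (R∨₁ e)    s t = R∨₁ (cutʳ-⊆ d e s t)
cutʳ-⊆ d (R∨₂ e)    s t = R∨₂ (cutʳ-⊆ d e s t)
cutʳ-⊆ d (R⇒ e)     s t = R⇒ (cutʳ-⊆-∷ d e s t)
cutʳ-⊆ d (LW e)     s t = cutʳ-⊆ d e s (t ∘′ there)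
cutʳ-⊆ d (LC e)     s t = cutʳ-⊆ d e s (∈-∷⁺ʳ (t (here refl)) t)
cutʳ-⊆ d (K□ e)     s t = cut-K□ d e s t
cutʳ-⊆ d (K◇ e)     s t = cut-K◇ d e s t

cutʳ-⊆-∷ d e s t = cutʳ-⊆ d e (there ∘′ s) (∷⁺-under t)

cut-R∨-L∨ (R∨₁ d) e₁ _ s = cut-⊆ d e₁ s ⊆-refl
cut-R∨-L∨ (R∨₂ d) _ e₂ s = cut-⊆ d e₂ s ⊆-refl

cut-K□ (K□ {Σ = Σ₁} d) e s t with Σ′ , □Σ′⊆Θ , Σ⊆BΣ′ ← □*-⊆-□∷ t =
  ⊢-resp-⊆ (□*-++-⊆ s □Σ′⊆Θ)
    (K□ (cut-⊆ d e (xs⊆xs++ys Σ₁ Σ′) (⊆-trans Σ⊆BΣ′ (∷⁺ʳ _ (xs⊆ys++xs Σ′ Σ₁)))))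
cut-K□ (R∧ _ _) e _ t = ⊢-resp-⊆ (⊆∷∧∉⇒⊆ t (∉-□* λ ())) (K□ e)
cut-K□ (R∨₁ _)  e _ t = ⊢-resp-⊆ (⊆∷∧∉⇒⊆ t (∉-□* λ ())) (K□ e)
cut-K□ (R∨₂ _)  e _ t = ⊢-resp-⊆ (⊆∷∧∉⇒⊆ t (∉-□* λ ())) (K□ e)
cut-K□ (R⇒ _)   e _ t = ⊢-resp-⊆ (⊆∷∧∉⇒⊆ t (∉-□* λ ())) (K□ e)
cut-K□ (K◇ _)   e _ t = ⊢-resp-⊆ (⊆∷∧∉⇒⊆ t (∉-□* λ ())) (K□ e)

cut-K◇ (K□ {Σ = Σ₁} d) e s t
  with there ◇P∈Θ ← t (here refl) | Σ′ , □Σ′⊆Θ , Σ⊆BΣ′ ← □*-⊆-□∷ (t ∘′ there) =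
  ⊢-resp-⊆ (∈-∷⁺ʳ ◇P∈Θ (□*-++-⊆ s □Σ′⊆Θ))
    (K◇ (cut-⊆ d e (there ∘′ xs⊆xs++ys Σ₁ Σ′)
                   (∷⁺-under (⊆-trans Σ⊆BΣ′ (∷⁺ʳ _ (xs⊆ys++xs Σ′ Σ₁))))))
cut-K◇ (K◇ {Σ = Σ₁} d) e s t with t (here refl)
... | here refl =
  ⊢-resp-⊆ (∈-∷⁺ʳ (s (here refl)) (□*-++-⊆ (s ∘′ there) (⊆∷∧∉⇒⊆ (t ∘′ there) (∉-□* λ ()))))
    (K◇ (cut-⊆ d e (∷⁺ʳ _ (xs⊆xs++ys Σ₁ _)) (∷⁺ʳ _ (there ∘′ xs⊆ys++xs _ Σ₁))))
... | there ◇P∈Θ = ⊢-resp-⊆ (∈-∷⁺ʳ ◇P∈Θ (⊆∷∧∉⇒⊆ (t ∘′ there) (∉-□* λ ()))) (K◇ e)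
cut-K◇ (R∧ _ _) e _ t = ⊢-resp-⊆ (⊆∷∧∉⇒⊆ t (∉-◇∷□* (λ ()) (λ ()))) (K◇ e)
cut-K◇ (R∨₁ _)  e _ t = ⊢-resp-⊆ (⊆∷∧∉⇒⊆ t (∉-◇∷□* (λ ()) (λ ()))) (K◇ e)
cut-K◇ (R∨₂ _)  e _ t = ⊢-resp-⊆ (⊆∷∧∉⇒⊆ t (∉-◇∷□* (λ ()) (λ ()))) (K◇ e)
cut-K◇ (R⇒ _)   e _ t = ⊢-resp-⊆ (⊆∷∧∉⇒⊆ t (∉-◇∷□* (λ ()) (λ ()))) (K◇ e)

mainTheorem7 : ∀ {Γ Σ : List Fm} {A C : Fm} → Γ ⊢ A → A ∷ Σ ⊢ C → Γ ++ Σ ⊢ C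
mainTheorem7 {Γ} {Σ} {A} d e = cut-⊆ d e (xs⊆xs++ys Γ Σ) (∷⁺ʳ A (xs⊆ys++xs Σ Γ))
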